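{- Let $n\ge 2$, $0\le r\le n$, let $e\ne f\in[n]$ and let $\pi=(e\,f)$ be the transposition exchanging $e$ and $f$. Let $H$ be the subgraph of the Johnson graph $J(n,r)$ induced by the $r$-sets containing exactly one of $e,f$ (so $H\cong J(n-2,r-1)\,\square\,K_2$), and for $k\ge 0$ let $i_k(H)$ be the number of stable sets of $H$ of cardinality $k$. Then for every integer $k\ge 0$ with $i_k(H)>0$, $$i_\pi(J(n,r))\le\frac{(r(n-r))^k}{i_k(H)}\, i(J(n,r)),$$ where $i(J(n,r))$ is the number of stable sets of $J(n,r)$ and $i_\pi(J(n,r))$ the number of $\pi$-invariant stable sets of $J(n,r)$.
   Context: The Johnson graph $J(n,r)$ has vertex set $\binom{[n]}{r}$, with $X,Y$ adjacent iff $|X\triangle Y|=2$. A stable set is a set of pairwise non-adjacent vertices (the empty set included). $\pi$ acts on vertices by $\pi(X)=\{\pi(x):x\in X\}$, and a set $I$ of vertices is $\pi$-invariant if $\pi(I)=I$. $\square$ denotes the Cartesian product of graphs. -}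

module Defs where

open import Data.Nat using (ℕ; zero; suc; _≡ᵇ_)
open import Data.Bool using (Bool; true; false; _∧_; _∨_; not; _xor_)
import Data.Bool as B
open import Data.Fin using (Fin)
open import Data.Fin.Subset using (Subset; ∣_∣; _∩_; _∪_; ∁; inside; outside)
open import Data.Fin.Permutation.Components using (transpose)
open import Data.Vec using (Vec; []; _∷_; lookup; tabulate)
open import Data.Vec.Properties using (≡-dec)
open import Data.List using (List; []; _∷_; [_]; map; _++_; filterᵇ; length)
open import Data.Bool.ListAction using (all; any)
open import Relation.Nullary.Decidable using (⌊_⌋)

allSubsets : (n : ℕ) → List (Subset n)
allSubsets zero = [ [] ]
allSubsets (suc n) = map (outside ∷_) (allSubsets n) ++ map (inside ∷_) (allSubsets n)

_==ˢ_ : {n : ℕ} → Subset n → Subset n → Bool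
X ==ˢ Y = ⌊ ≡-dec B._≟_ X Y ⌋

_△_ : {n : ℕ} → Subset n → Subset n → Subset n
X △ Y = (X ∩ ∁ Y) ∪ (Y ∩ ∁ X)

adjJ : {n : ℕ} → Subset n → Subset n → Bool
adjJ X Y = ∣ X △ Y ∣ ≡ᵇ 2

JohnsonVertices : (n r : ℕ) → List (Subset n)
JohnsonVertices n r = filterᵇ (λ X → ∣ X ∣ ≡ᵇ r) (allSubsets n)

HVertices : (n r : ℕ) → Fin n → Fin n → List (Subset n)
HVertices n r e f = filterᵇ (λ X → lookup X e xor lookup X f) (JohnsonVertices n r)

-- a set of vertices of the (induced) subgraph with vertex list vs is a
-- selection S ⊆ indices of vs; its members:
members : {n : ℕ} (vs : List (Subset n)) → Subset (length vs) → List (Subset n)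
members [] [] = []
members (v ∷ vs) (true ∷ S) = v ∷ members vs S
members (v ∷ vs) (false ∷ S) = members vs S

stable : {n : ℕ} (vs : List (Subset n)) → Subset (length vs) → Bool
stable vs S = all (λ X → all (λ Y → not (adjJ X Y)) (members vs S)) (members vs S)

-- action of a permutation given by σ : Fin n → Fin n with σ an involution
-- (here the transposition (e f)): π(X) = {π(x) : x ∈ X}, i.e. y ∈ π(X) iff π⁻¹(y) ∈ X
act : {n : ℕ} → Fin n → Fin n → Subset n → Subset n
act e f X = tabulate (λ y → lookup X (transpose e f y))

invariant : {n : ℕ} (e f : Fin n) (vs : List (Subset n)) → Subset (length vs) → Bool
invariant e f vs S =
  all (λ X → any (λ Y → Y ==ˢ act e f X) (members vs S)) (members vs S)
  ∧ all (λ Y → any (λ X → act e f X ==ˢ Y) (members vs S)) (members vs S)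

iJ : (n r : ℕ) → ℕ
iJ n r = length (filterᵇ (stable (JohnsonVertices n r)) (allSubsets (length (JohnsonVertices n r))))

iπJ : (n r : ℕ) → Fin n → Fin n → ℕ
iπJ n r e f = length (filterᵇ (λ S → stable (JohnsonVertices n r) S ∧ invariant e f (JohnsonVertices n r) S)
                              (allSubsets (length (JohnsonVertices n r))))

ikH : (n r : ℕ) → Fin n → Fin n → ℕ → ℕ
ikH n r e f k = length (filterᵇ (λ S → stable (HVertices n r e f) S ∧ (∣ S ∣ ≡ᵇ k))
                                (allSubsets (length (HVertices n r e f))))

-- A π-invariant stable set I avoids H, because every X ∈ H is adjacent to π(X) (they differ exactly
-- in e and f). Fix a stable k-set S of H and replace I by (I ∖ N(S)) ∪ S: this is a stable set of
-- J(n,r) whose trace on H is S. Let s ∈ S, with p the point of {e,f} in s and q the other one. The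
-- neighbours of s outside H are s − p + b (b ∉ s) and s − a + q (a ∈ s), and two neighbours of the
-- same shape are adjacent, so I contains at most one of each: the pair (a, b) ∈ s × ∁s, with a = p
-- resp. b = q meaning "none", records I ∩ N(s). Together with (I ∖ N(S)) ∪ S these k pairs determine
-- I, so i_π(J) ≤ (r(n−r))^k · #{stable J′ : J′ ∩ H = S}, and summing over the disjoint classes S
-- gives i_π(J) · i_k(H) ≤ (r(n−r))^k · i(J).

module Submission where

open import Defs
open import Data.Nat using (ℕ; _≤_; _<_; _*_; _∸_; _^_)
open import Data.Fin using (Fin)
open import Relation.Binary.PropositionalEquality using (_≢_)

open import Level using (Level)
open import Data.Nat using (zero; suc; _+_; z≤n; s≤s; _≡ᵇ_)
open import Data.Nat.Properties
  using (≡ᵇ⇒≡; ≡⇒≡ᵇ; suc-injective; m≢1+n+m; +-mono-≤; *-distribˡ-+; *-comm; *-monoʳ-≤; module ≤-Reasoning)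
open import Data.Nat.ListAction using (sum)
open import Data.Bool using (Bool; true; false; _∧_; _∨_; not; _xor_; if_then_else_; T; T?)
import Data.Bool as Bool
open import Data.Bool.Properties
  using (T-≡; T-not-≡; T-∧; xor-comm; xor-same; ∨-zeroʳ; ∨-identityʳ; ∧-identityʳ; ∧-zeroʳ)
open import Data.Bool.ListAction using (any)
open import Data.Fin using (zero; suc; _≟_)
open import Data.Fin.Properties using (any?) renaming (suc-injective to fsuc-injective)
open import Data.Fin.Subset using (Subset; ∣_∣; ∁)
open import Data.Fin.Subset.Properties using (∣∁p∣≡n∸∣p∣)
open import Data.Fin.Permutation.Components using (transpose)
open import Data.Vec as Vec using (Vec; []; _∷_; lookup; tabulate)
open import Data.Vec.Properties using (≡-dec; lookup∘tabulate; tabulate∘lookup; tabulate-cong; lookup-map)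
open import Data.List as List
  using (List; []; _∷_; [_]; _++_; length; map; filterᵇ; concatMap; allFin; cartesianProduct; cartesianProductWith)
open import Data.List.Properties using (length-++; length-map; length-++-sucʳ; ∷-injective)
open import Data.List.Membership.Propositional using (_∈_; _∉_; find)
open import Data.List.Membership.Propositional.Properties
  using (∈-∃++; ∈-++⁻; ∈-++⁺ˡ; ∈-++⁺ʳ; ∈-map⁺; ∈-map⁻; ∈-filter⁺; ∈-filter⁻; ∈-allFin; ∈-lookup;
         ∈-cartesianProductWith⁺; ∈-concatMap⁻)
open import Data.List.Relation.Binary.Subset.Propositional using (_⊆_)
open import Data.List.Relation.Binary.Disjoint.Propositional using (Disjoint)
open import Data.List.Relation.Unary.Any as Any using (Any; here; there)
open import Data.List.Relation.Unary.Any.Properties using (any⁺; any⁻; lookup-index)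
open import Data.List.Relation.Unary.All as All using (All; []; _∷_)
import Data.List.Relation.Unary.All.Properties as All
open import Data.List.Relation.Unary.AllPairs as AllPairs using ([]; _∷_)
import Data.List.Relation.Unary.AllPairs.Properties as AllPairs
open import Data.List.Relation.Unary.Unique.Propositional using (Unique)
import Data.List.Relation.Unary.Unique.Propositional.Properties as Unique
open import Data.Product using (∃; _×_; _,_; proj₁; proj₂)
open import Data.Sum using (_⊎_; inj₁; inj₂)
open import Function using (_∘_; id; _⇔_; mk⇔; Equivalence)
open import Function.Construct.Composition using (_⇔-∘_)
open import Function.Construct.Symmetry using (⇔-sym)
open import Relation.Nullary using (¬_; Dec; yes; no; does; contradiction)
open import Relation.Nullary.Decidable using (toWitness; fromWitness; dec-true; dec-false; _×-dec_)
open import Relation.Unary using (Pred; Decidable)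
open import Relation.Binary.PropositionalEquality
  using (_≡_; refl; sym; trans; cong; cong₂; subst; module ≡-Reasoning)

private
  variable
    a b c ℓ : Level
    n : ℕ
    A : Set a
    B : Set b
    C : Set c

injection⇒length≤ : {xs : List A} (ys : List B) (g : A → B) → Unique xs →
                    (∀ {x y} → x ∈ xs → y ∈ xs → g x ≡ g y → x ≡ y) →
                    (∀ {x} → x ∈ xs → g x ∈ ys) → length xs ≤ length ys
injection⇒length≤ {xs = []} ys g _ _ _ = z≤n
injection⇒length≤ {xs = x ∷ xs} ys g (x∉xs ∷ xs!) inj into with ∈-∃++ (into (here refl))
... | us , vs , refl = begin
    suc (length xs)            ≤⟨ s≤s (injection⇒length≤ (us ++ vs) g xs! (λ p q → inj (there p) (there q)) into′) ⟩
    suc (length (us ++ vs))    ≡⟨ length-++-sucʳ us (g x) vs ⟨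
    length (us ++ g x ∷ vs)    ∎
  where
  open ≤-Reasoning
  into′ : ∀ {y} → y ∈ xs → g y ∈ us ++ vs
  into′ {y} y∈xs with ∈-++⁻ us (into (there y∈xs))
  ... | inj₁ p         = ∈-++⁺ˡ p
  ... | inj₂ (here eq) = contradiction (sym (inj (there y∈xs) (here refl) eq)) (All.lookup x∉xs y∈xs)
  ... | inj₂ (there p) = ∈-++⁺ʳ us p

unique-⊆⇒length≤ : {xs ys : List A} → Unique xs → xs ⊆ ys → length xs ≤ length ys
unique-⊆⇒length≤ xs! xs⊆ys = injection⇒length≤ _ id xs! (λ _ _ eq → eq) xs⊆ys

length*≤*sum : ∀ {c d} (g : A → ℕ) (xs : List A) → (∀ {x} → x ∈ xs → c ≤ d * g x) →
               length xs * c ≤ d * sum (map g xs)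
length*≤*sum g [] _ = z≤n
length*≤*sum {c = c} {d} g (x ∷ xs) bound = begin
  c + length xs * c              ≤⟨ +-mono-≤ (bound (here refl)) (length*≤*sum {d = d} g xs (bound ∘ there)) ⟩
  d * g x + d * sum (map g xs)   ≡⟨ *-distribˡ-+ d (g x) _ ⟨
  d * (g x + sum (map g xs))     ∎
  where open ≤-Reasoning

length-cartesianProductWith : (f : A → B → C) (xs : List A) (ys : List B) →
                              length (cartesianProductWith f xs ys) ≡ length xs * length ys
length-cartesianProductWith f [] ys = refl
length-cartesianProductWith f (x ∷ xs) ys = begin
  length (map (f x) ys ++ cartesianProductWith f xs ys)         ≡⟨ length-++ (map (f x) ys) ⟩
  length (map (f x) ys) + length (cartesianProductWith f xs ys) ≡⟨ cong₂ _+_ (length-map (f x) ys)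
                                                                          (length-cartesianProductWith f xs ys) ⟩
  length ys + length xs * length ys                             ∎
  where open ≡-Reasoning

length-concatMap : (f : A → List B) (xs : List A) → length (concatMap f xs) ≡ sum (map (length ∘ f) xs)
length-concatMap f [] = refl
length-concatMap f (x ∷ xs) = trans (length-++ (f x)) (cong (length (f x) +_) (length-concatMap f xs))

map-≡⇒≡-on : (g h : A → B) {xs : List A} → map g xs ≡ map h xs → ∀ {x} → x ∈ xs → g x ≡ h x
map-≡⇒≡-on g h {_ ∷ _} eq (here refl) = proj₁ (∷-injective eq)
map-≡⇒≡-on g h {_ ∷ _} eq (there x∈xs) = map-≡⇒≡-on g h (proj₂ (∷-injective eq)) x∈xs

lookup-injective : (xs : List A) → Unique xs → ∀ i j → List.lookup xs i ≡ List.lookup xs j → i ≡ j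
lookup-injective (x ∷ xs) _          zero    zero    _  = refl
lookup-injective (x ∷ xs) (x∉ ∷ _)   zero    (suc j) eq = contradiction eq (All.lookup x∉ (∈-lookup j))
lookup-injective (x ∷ xs) (x∉ ∷ _)   (suc i) zero    eq = contradiction (sym eq) (All.lookup x∉ (∈-lookup i))
lookup-injective (x ∷ xs) (_ ∷ xs!)  (suc i) (suc j) eq = cong suc (lookup-injective xs xs! i j eq)

≡-from-⇔ : {x y : Bool} → (x ≡ true ⇔ y ≡ true) → x ≡ y
≡-from-⇔ {true}  {true}  _ = refl
≡-from-⇔ {false} {false} _ = refl
≡-from-⇔ {true}  {false} x⇔y = sym (Equivalence.to x⇔y refl)
≡-from-⇔ {false} {true}  x⇔y = Equivalence.from x⇔y refl

≡-from-⇔≡ : {x y : Bool} {c₁ c₂ b : A} → (x ≡ true ⇔ c₁ ≡ b) → (y ≡ true ⇔ c₂ ≡ b) → c₁ ≡ c₂ →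
            x ≡ y
≡-from-⇔≡ x⇔ y⇔ c₁≡c₂ =
  ≡-from-⇔ (⇔-sym y⇔ ⇔-∘ (mk⇔ (trans (sym c₁≡c₂)) (trans c₁≡c₂) ⇔-∘ x⇔))

does⇔ : (d : Dec A) → does d ≡ true ⇔ A
does⇔ (yes a)  = mk⇔ (λ _ → a) (λ _ → refl)
does⇔ (no ¬a)  = mk⇔ (λ ()) (λ a → contradiction a ¬a)

∈-filterᵇ⇒T : (p : A → Bool) (xs : List A) {x : A} → x ∈ filterᵇ p xs → T (p x)
∈-filterᵇ⇒T p xs = proj₂ ∘ ∈-filter⁻ (T? ∘ p) {xs = xs}

≡false⇒¬T : ∀ {x} → x ≡ false → ¬ T x
≡false⇒¬T refl ()

T-not⇒¬T : ∀ {x} → T (not x) → ¬ T x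
T-not⇒¬T {false} _ ()

¬T⇒T-not : ∀ {x} → ¬ T x → T (not x)
¬T⇒T-not {true} ¬t = ¬t _
¬T⇒T-not {false} _ = _

¬T-xor⇒≡ : ∀ {x y} → ¬ T (x xor y) → x ≡ y
¬T-xor⇒≡ {true}  {true}  _ = refl
¬T-xor⇒≡ {false} {false} _ = refl
¬T-xor⇒≡ {true}  {false} ¬t = contradiction _ ¬t
¬T-xor⇒≡ {false} {true}  ¬t = contradiction _ ¬t

T-xor⇒≡not : ∀ {x y} → T (x xor y) → x ≡ not y
T-xor⇒≡not {true}  {false} _ = refl
T-xor⇒≡not {false} {true}  _ = refl

lookup-extensionality : ∀ {n} (xs ys : Vec A n) → (∀ i → lookup xs i ≡ lookup ys i) → xs ≡ ys
lookup-extensionality xs ys eq = trans (sym (tabulate∘lookup xs)) (trans (tabulate-cong eq) (tabulate∘lookup ys))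

∈-allSubsets : ∀ {n} (X : Subset n) → X ∈ allSubsets n
∈-allSubsets []            = here refl
∈-allSubsets {suc n} (false ∷ X) = ∈-++⁺ˡ (∈-map⁺ (false ∷_) (∈-allSubsets X))
∈-allSubsets {suc n} (true ∷ X)  = ∈-++⁺ʳ (map (false ∷_) (allSubsets n)) (∈-map⁺ (true ∷_) (∈-allSubsets X))

allSubsets-unique : ∀ n → Unique (allSubsets n)
allSubsets-unique zero    = [] ∷ []
allSubsets-unique (suc n) =
  Unique.++⁺ (Unique.map⁺ (cong Vec.tail) (allSubsets-unique n))
             (Unique.map⁺ (cong Vec.tail) (allSubsets-unique n))
             heads-differ
  where
  heads-differ : Disjoint (map (false ∷_) (allSubsets n)) (map (true ∷_) (allSubsets n))
  heads-differ (p , q) with ∈-map⁻ (false ∷_) p | ∈-map⁻ (true ∷_) q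
  ... | _ , _ , refl | _ , _ , ()

elements : ∀ {n} → Subset n → List (Fin n)
elements {n} s = filterᵇ (lookup s) (allFin n)

∈-elements : (s : Subset n) {x : Fin n} → lookup s x ≡ true → x ∈ elements s
∈-elements s sx = ∈-filter⁺ (T? ∘ lookup s) (∈-allFin _) (Equivalence.from T-≡ sx)

length-filterᵇ-tabulate : ∀ {n} (p : A → Bool) (g : Fin n → A) →
                          length (filterᵇ p (List.tabulate g)) ≡ ∣ tabulate (p ∘ g) ∣
length-filterᵇ-tabulate {n = zero}  p g = refl
length-filterᵇ-tabulate {n = suc n} p g with p (g zero)
... | true  = cong suc (length-filterᵇ-tabulate p (g ∘ suc))
... | false = length-filterᵇ-tabulate p (g ∘ suc)

length-elements : ∀ {n} (s : Subset n) → length (elements s) ≡ ∣ s ∣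
length-elements s = trans (length-filterᵇ-tabulate (lookup s) id) (cong ∣_∣ (tabulate∘lookup s))

xor-as-△ : ∀ x y → (x ∧ not y) ∨ (y ∧ not x) ≡ x xor y
xor-as-△ true  true  = refl
xor-as-△ true  false = refl
xor-as-△ false true  = refl
xor-as-△ false false = refl

≡not⇒xor : ∀ {x y} → x ≡ not y → x xor y ≡ true
≡not⇒xor {y = true}  refl = refl
≡not⇒xor {y = false} refl = refl

lookup-△ : (X Y : Subset n) (i : Fin n) → lookup (X △ Y) i ≡ lookup X i xor lookup Y i
lookup-△ (x ∷ X) (y ∷ Y) zero    = xor-as-△ x y
lookup-△ (x ∷ X) (y ∷ Y) (suc i) = lookup-△ X Y i

△-comm : (X Y : Subset n) → X △ Y ≡ Y △ X
△-comm X Y = lookup-extensionality _ _ λ i →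
  trans (lookup-△ X Y i) (trans (xor-comm (lookup X i) (lookup Y i)) (sym (lookup-△ Y X i)))

adjJ-sym : (X Y : Subset n) → adjJ X Y ≡ adjJ Y X
adjJ-sym X Y = cong (λ Z → ∣ Z ∣ ≡ᵇ 2) (△-comm X Y)

∣Z∣≡0 : (Z : Subset n) → (∀ x → lookup Z x ≡ false) → ∣ Z ∣ ≡ 0
∣Z∣≡0 []      _     = refl
∣Z∣≡0 (z ∷ Z) empty with empty zero
... | refl = ∣Z∣≡0 Z (empty ∘ suc)

∣Z∣≡1 : (Z : Subset n) (i : Fin n) → lookup Z i ≡ true → (∀ x → x ≢ i → lookup Z x ≡ false) → ∣ Z ∣ ≡ 1
∣Z∣≡1 (z ∷ Z) zero    refl only = cong suc (∣Z∣≡0 Z (λ x → only (suc x) λ ()))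
∣Z∣≡1 (z ∷ Z) (suc i) Zi   only with only zero (λ ())
... | refl = ∣Z∣≡1 Z i Zi (λ x x≢i → only (suc x) (x≢i ∘ fsuc-injective))

∣Z∣≡2 : (Z : Subset n) {i j : Fin n} → i ≢ j → lookup Z i ≡ true → lookup Z j ≡ true →
        (∀ x → x ≢ i → x ≢ j → lookup Z x ≡ false) → ∣ Z ∣ ≡ 2
∣Z∣≡2 (z ∷ Z) {zero}  {zero}  i≢j _    _  _    = contradiction refl i≢j
∣Z∣≡2 (z ∷ Z) {zero}  {suc j} _   refl Zj only =
  cong suc (∣Z∣≡1 Z j Zj (λ x x≢j → only (suc x) (λ ()) (x≢j ∘ fsuc-injective)))
∣Z∣≡2 (z ∷ Z) {suc i} {zero}  _   Zi refl only =
  cong suc (∣Z∣≡1 Z i Zi (λ x x≢i → only (suc x) (x≢i ∘ fsuc-injective) (λ ())))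
∣Z∣≡2 (z ∷ Z) {suc i} {suc j} i≢j Zi Zj only with only zero (λ ()) (λ ())
... | refl = ∣Z∣≡2 Z (i≢j ∘ cong suc) Zi Zj
               (λ x x≢i x≢j → only (suc x) (x≢i ∘ fsuc-injective) (x≢j ∘ fsuc-injective))

differ-at-two⇒adjJ : (X Y : Subset n) {i j : Fin n} → i ≢ j →
                     lookup X i ≡ not (lookup Y i) → lookup X j ≡ not (lookup Y j) →
                     (∀ x → x ≢ i → x ≢ j → lookup X x ≡ lookup Y x) → T (adjJ X Y)
differ-at-two⇒adjJ X Y i≢j Xi Xj agree =
  ≡⇒≡ᵇ _ 2 (∣Z∣≡2 (X △ Y) i≢j (differs Xi) (differs Xj) (λ x x≢i x≢j → agrees (agree x x≢i x≢j)))
  where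
  differs : ∀ {x} → lookup X x ≡ not (lookup Y x) → lookup (X △ Y) x ≡ true
  differs {x} eq = trans (lookup-△ X Y x) (≡not⇒xor eq)
  agrees : ∀ {x} → lookup X x ≡ lookup Y x → lookup (X △ Y) x ≡ false
  agrees {x} eq = trans (lookup-△ X Y x) (trans (cong (_xor lookup Y x) eq) (xor-same (lookup Y x)))

△≡0⇒≡ : (X Y : Subset n) → ∣ X △ Y ∣ ≡ 0 → X ≡ Y
△≡0⇒≡ []          []          _ = refl
△≡0⇒≡ (true ∷ X)  (true ∷ Y)  h = cong (true ∷_) (△≡0⇒≡ X Y h)
△≡0⇒≡ (false ∷ X) (false ∷ Y) h = cong (false ∷_) (△≡0⇒≡ X Y h)

∈∉⇒≢ : (s : Subset n) {x y : Fin n} → lookup s x ≡ true → lookup s y ≡ false → x ≢ y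
∈∉⇒≢ s sx sy refl = contradiction (trans (sym sx) sy) λ ()

record Insertion (X Y : Subset n) : Set where
  field
    new       : Fin n
    X-new     : lookup X new ≡ false
    Y-new     : lookup Y new ≡ true
    elsewhere : ∀ x → x ≢ new → lookup X x ≡ lookup Y x

record Exchange (X Y : Subset n) : Set where
  field
    old new   : Fin n
    X-old     : lookup X old ≡ true
    Y-old     : lookup Y old ≡ false
    X-new     : lookup X new ≡ false
    Y-new     : lookup Y new ≡ true
    elsewhere : ∀ x → x ≢ old → x ≢ new → lookup X x ≡ lookup Y x

Insertion-∷ : ∀ {X Y : Subset n} z → Insertion X Y → Insertion (z ∷ X) (z ∷ Y)
Insertion-∷ z ins = record
  { new = suc new ; X-new = X-new ; Y-new = Y-new
  ; elsewhere = λ { zero _ → refl ; (suc x) x≢ → elsewhere x (x≢ ∘ cong suc) } }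
  where open Insertion ins

Exchange-∷ : ∀ {X Y : Subset n} z → Exchange X Y → Exchange (z ∷ X) (z ∷ Y)
Exchange-∷ z ex = record
  { old = suc old ; new = suc new ; X-old = X-old ; Y-old = Y-old ; X-new = X-new ; Y-new = Y-new
  ; elsewhere = λ { zero _ _ → refl ; (suc x) x≢o x≢n → elsewhere x (x≢o ∘ cong suc) (x≢n ∘ cong suc) } }
  where open Exchange ex

△≡1⇒Insertion : (X Y : Subset n) → ∣ X △ Y ∣ ≡ 1 → ∣ Y ∣ ≡ suc ∣ X ∣ → Insertion X Y
△≡1⇒Insertion (true ∷ X)  (true ∷ Y)  h c = Insertion-∷ true (△≡1⇒Insertion X Y h (suc-injective c))
△≡1⇒Insertion (false ∷ X) (false ∷ Y) h c = Insertion-∷ false (△≡1⇒Insertion X Y h c)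
△≡1⇒Insertion (false ∷ X) (true ∷ Y)  h c with △≡0⇒≡ X Y (suc-injective h)
... | refl = record { new = zero ; X-new = refl ; Y-new = refl
                    ; elsewhere = λ { zero 0≢0 → contradiction refl 0≢0 ; (suc x) _ → refl } }
△≡1⇒Insertion (true ∷ X)  (false ∷ Y) h c with △≡0⇒≡ X Y (suc-injective h)
... | refl = contradiction c (m≢1+n+m ∣ X ∣ {1})

△≡2⇒Exchange : (X Y : Subset n) → ∣ X ∣ ≡ ∣ Y ∣ → ∣ X △ Y ∣ ≡ 2 → Exchange X Y
△≡2⇒Exchange []          []          _ ()
△≡2⇒Exchange (true ∷ X)  (true ∷ Y)  c h =
  Exchange-∷ true (△≡2⇒Exchange X Y (suc-injective c) h)
△≡2⇒Exchange (false ∷ X) (false ∷ Y) c h =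
  Exchange-∷ false (△≡2⇒Exchange X Y c h)
△≡2⇒Exchange (true ∷ X)  (false ∷ Y) c h = record
  { old = zero ; new = suc new ; X-old = refl ; Y-old = refl ; X-new = X-new ; Y-new = Y-new
  ; elsewhere = λ { zero 0≢0 _ → contradiction refl 0≢0 ; (suc x) _ x≢n → elsewhere x (x≢n ∘ cong suc) } }
  where open Insertion (△≡1⇒Insertion X Y (suc-injective h) (sym c))
△≡2⇒Exchange (false ∷ X) (true ∷ Y)  c h = record
  { old = suc new ; new = zero ; X-old = Y-new ; Y-old = X-new ; X-new = refl ; Y-new = refl
  ; elsewhere = λ { zero _ 0≢0 → contradiction refl 0≢0
                  ; (suc x) x≢o _ → sym (elsewhere x (x≢o ∘ cong suc)) } }
  where open Insertion (△≡1⇒Insertion Y X (trans (cong ∣_∣ (△-comm Y X)) (suc-injective h)) c)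

replace : Subset n → Fin n → Fin n → Subset n
replace s a b = tabulate λ x → if does (x ≟ b) then true else if does (x ≟ a) then false else lookup s x

module _ (s : Subset n) (a b : Fin n) where

  lookup-replace : ∀ x → lookup (replace s a b) x ≡
                         (if does (x ≟ b) then true else if does (x ≟ a) then false else lookup s x)
  lookup-replace = lookup∘tabulate _

  lookup-replace-new : lookup (replace s a b) b ≡ true
  lookup-replace-new rewrite lookup-replace b | dec-true (b ≟ b) refl = refl

  lookup-replace-old : a ≢ b → lookup (replace s a b) a ≡ false
  lookup-replace-old a≢b rewrite lookup-replace a | dec-false (a ≟ b) a≢b | dec-true (a ≟ a) refl = refl

  lookup-replace-other : ∀ {x} → x ≢ a → x ≢ b → lookup (replace s a b) x ≡ lookup s x
  lookup-replace-other {x} x≢a x≢b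
    rewrite lookup-replace x | dec-false (x ≟ b) x≢b | dec-false (x ≟ a) x≢a = refl

  lookup-replace-≢new : ∀ {x} → x ≢ b → lookup (replace s a b) x ≡ (if does (x ≟ a) then false else lookup s x)
  lookup-replace-≢new {x} x≢b rewrite lookup-replace x | dec-false (x ≟ b) x≢b = refl

  lookup-replace-≢old : ∀ {x} → x ≢ a → lookup (replace s a b) x ≡ (if does (x ≟ b) then true else lookup s x)
  lookup-replace-≢old {x} x≢a rewrite lookup-replace x | dec-false (x ≟ a) x≢a with does (x ≟ b)
  ... | true  = refl
  ... | false = refl

Exchange⇒replace : {X Y : Subset n} (ex : Exchange X Y) → Y ≡ replace X (Exchange.old ex) (Exchange.new ex)
Exchange⇒replace {X = X} {Y} ex = lookup-extensionality _ _ agree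
  where
  open Exchange ex
  agree : ∀ x → lookup Y x ≡ lookup (replace X old new) x
  agree x with x ≟ new | x ≟ old
  ... | yes refl | _        = trans Y-new (sym (lookup-replace-new X old x))
  ... | no _     | yes refl = trans Y-old (sym (lookup-replace-old X x new (∈∉⇒≢ X X-old X-new)))
  ... | no x≢new | no x≢old =
    trans (sym (elsewhere x x≢old x≢new)) (sym (lookup-replace-other X old new x≢old x≢new))

module _ (s : Subset n) where

  replace-new-adjJ : ∀ {a b c} → lookup s a ≡ true → lookup s b ≡ false → lookup s c ≡ false → b ≢ c →
                     T (adjJ (replace s a b) (replace s a c))
  replace-new-adjJ {a} {b} {c} sa sb sc b≢c =
    differ-at-two⇒adjJ (replace s a b) (replace s a c) b≢c at-b at-c
      (λ x x≢b x≢c → trans (lookup-replace-≢new s a b x≢b) (sym (lookup-replace-≢new s a c x≢c)))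
    where
    at-b : lookup (replace s a b) b ≡ not (lookup (replace s a c) b)
    at-b = trans (lookup-replace-new s a b)
                 (sym (cong not (trans (lookup-replace-other s a c (∈∉⇒≢ s sa sb ∘ sym) b≢c) sb)))
    at-c : lookup (replace s a b) c ≡ not (lookup (replace s a c) c)
    at-c = trans (lookup-replace-other s a b (∈∉⇒≢ s sa sc ∘ sym) (b≢c ∘ sym))
                 (trans sc (sym (cong not (lookup-replace-new s a c))))

  replace-old-adjJ : ∀ {a b c} → lookup s a ≡ true → lookup s b ≡ true → lookup s c ≡ false → a ≢ b →
                     T (adjJ (replace s a c) (replace s b c))
  replace-old-adjJ {a} {b} {c} sa sb sc a≢b =
    differ-at-two⇒adjJ (replace s a c) (replace s b c) a≢b at-a at-b
      (λ x x≢a x≢b → trans (lookup-replace-≢old s a c x≢a) (sym (lookup-replace-≢old s b c x≢b)))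
    where
    at-a : lookup (replace s a c) a ≡ not (lookup (replace s b c) a)
    at-a = trans (lookup-replace-old s a c (∈∉⇒≢ s sa sc))
                 (sym (cong not (trans (lookup-replace-other s b c a≢b (∈∉⇒≢ s sa sc)) sa)))
    at-b : lookup (replace s a c) b ≡ not (lookup (replace s b c) b)
    at-b = trans (lookup-replace-other s a c (a≢b ∘ sym) (∈∉⇒≢ s sb sc))
                 (trans sb (sym (cong not (lookup-replace-old s b c (∈∉⇒≢ s sb sc)))))

module _ {s Y : Subset n} (ex : Exchange s Y) where
  open Exchange ex

  Exchange-shapes : ∀ {p q} → lookup s p ≡ true → lookup s q ≡ false → lookup Y p ≡ lookup Y q →
                    (∃ λ b → lookup s b ≡ false × b ≢ q × Y ≡ replace s p b) ⊎
                    (∃ λ a → lookup s a ≡ true × a ≢ p × Y ≡ replace s a q)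
  Exchange-shapes {p} {q} sp sq Yp≡Yq with old ≟ p | new ≟ q
  ... | yes refl | _        = inj₁ (new , X-new , new≢q , Exchange⇒replace ex)
    where
    new≢q : new ≢ q
    new≢q refl = contradiction (trans (sym Y-new) (trans (sym Yp≡Yq) Y-old)) λ ()
  ... | no old≢p | yes refl = inj₂ (old , X-old , old≢p , Exchange⇒replace ex)
  ... | no old≢p | no new≢q = contradiction (trans (sym Yp) (trans Yp≡Yq Yq)) λ ()
    where
    Yp : lookup Y p ≡ true
    Yp = trans (sym (elsewhere p (old≢p ∘ sym) (∈∉⇒≢ s sp X-new))) sp
    Yq : lookup Y q ≡ false
    Yq = trans (sym (elsewhere q (∈∉⇒≢ s X-old sq ∘ sym) (new≢q ∘ sym))) sq

neighbour-shapes : {s Y : Subset n} {p q : Fin n} → lookup s p ≡ true → lookup s q ≡ false →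
                   ∣ s ∣ ≡ ∣ Y ∣ → T (adjJ s Y) → lookup Y p ≡ lookup Y q →
                   (∃ λ b → lookup s b ≡ false × b ≢ q × Y ≡ replace s p b) ⊎
                   (∃ λ a → lookup s a ≡ true × a ≢ p × Y ≡ replace s a q)
neighbour-shapes {s = s} {Y} sp sq ∣s∣≡∣Y∣ adj =
  Exchange-shapes (△≡2⇒Exchange s Y ∣s∣≡∣Y∣ (≡ᵇ⇒≡ _ 2 adj)) sp sq

transpose-matchˡ : (i j : Fin n) → transpose i j i ≡ j
transpose-matchˡ i j rewrite dec-true (i ≟ i) refl = refl

transpose-matchʳ : (i j : Fin n) → i ≢ j → transpose i j j ≡ i
transpose-matchʳ i j i≢j rewrite dec-false (j ≟ i) (i≢j ∘ sym) | dec-true (j ≟ j) refl = refl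

transpose-other : (i j : Fin n) {k : Fin n} → k ≢ i → k ≢ j → transpose i j k ≡ k
transpose-other i j {k} k≢i k≢j rewrite dec-false (k ≟ i) k≢i | dec-false (k ≟ j) k≢j = refl

act-adjJ : {e f : Fin n} → e ≢ f → (X : Subset n) → T (lookup X e xor lookup X f) → T (adjJ X (act e f X))
act-adjJ {e = e} {f} e≢f X Xe⊕Xf = differ-at-two⇒adjJ X (act e f X) e≢f
  (trans (T-xor⇒≡not Xe⊕Xf) (cong not (sym (trans (lookup-act e) (cong (lookup X) (transpose-matchˡ e f))))))
  (trans (T-xor⇒≡not (subst T (xor-comm (lookup X e) _) Xe⊕Xf))
         (cong not (sym (trans (lookup-act f) (cong (lookup X) (transpose-matchʳ e f e≢f))))))
  (λ x x≢e x≢f → sym (trans (lookup-act x) (cong (lookup X) (transpose-other e f x≢e x≢f))))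
  where
  lookup-act : ∀ y → lookup (act e f X) y ≡ lookup X (transpose e f y)
  lookup-act = lookup∘tabulate _

_∈ˢ?_ : (X : Subset n) (Xs : List (Subset n)) → Dec (X ∈ Xs)
X ∈ˢ? Xs = Any.any? (≡-dec Bool._≟_ X) Xs

∈-members⁺ : (vs : List (Subset n)) (S : Subset (length vs)) {i : Fin (length vs)} →
             lookup S i ≡ true → List.lookup vs i ∈ members vs S
∈-members⁺ (v ∷ vs) (true  ∷ S) {zero}  _  = here refl
∈-members⁺ (v ∷ vs) (true  ∷ S) {suc i} Si = there (∈-members⁺ vs S Si)
∈-members⁺ (v ∷ vs) (false ∷ S) {suc i} Si = ∈-members⁺ vs S Si

∈-members⁻ : (vs : List (Subset n)) (S : Subset (length vs)) {X : Subset n} →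
             X ∈ members vs S → ∃ λ i → lookup S i ≡ true × List.lookup vs i ≡ X
∈-members⁻ []       []          ()
∈-members⁻ (v ∷ vs) (true  ∷ S) (here refl) = zero , refl , refl
∈-members⁻ (v ∷ vs) (true  ∷ S) (there X∈)  = let i , Si , eq = ∈-members⁻ vs S X∈ in suc i , Si , eq
∈-members⁻ (v ∷ vs) (false ∷ S) X∈          = let i , Si , eq = ∈-members⁻ vs S X∈ in suc i , Si , eq

members-⊆ : (vs : List (Subset n)) (S : Subset (length vs)) → members vs S ⊆ vs
members-⊆ vs S X∈ with ∈-members⁻ vs S X∈
... | i , _ , refl = ∈-lookup i

length-members : (vs : List (Subset n)) (S : Subset (length vs)) → length (members vs S) ≡ ∣ S ∣
length-members []       []          = refl
length-members (v ∷ vs) (true  ∷ S) = cong suc (length-members vs S)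
length-members (v ∷ vs) (false ∷ S) = length-members vs S

lookup∈members⇔ : {vs : List (Subset n)} → Unique vs → (S : Subset (length vs)) (i : Fin (length vs)) →
                  List.lookup vs i ∈ members vs S ⇔ lookup S i ≡ true
lookup∈members⇔ {vs = vs} vs! S i = mk⇔ to (∈-members⁺ vs S)
  where
  to : List.lookup vs i ∈ members vs S → lookup S i ≡ true
  to v∈ with ∈-members⁻ vs S v∈
  ... | j , Sj , eq with lookup-injective vs vs! j i eq
  ...   | refl = Sj

stable⁻ : (vs : List (Subset n)) (S : Subset (length vs)) → T (stable vs S) →
          ∀ {X Y} → X ∈ members vs S → Y ∈ members vs S → ¬ T (adjJ X Y)
stable⁻ vs S st {X} X∈ Y∈ = T-not⇒¬T (All.lookup (All.all⁺ _ _ (All.lookup (All.all⁺ _ _ st) X∈)) Y∈)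

stable⁺ : (vs : List (Subset n)) (S : Subset (length vs)) →
          (∀ {i j} → lookup S i ≡ true → lookup S j ≡ true → ¬ T (adjJ (List.lookup vs i) (List.lookup vs j))) →
          T (stable vs S)
stable⁺ vs S nonadjacent =
  All.all⁻ _ (All.tabulate λ X∈ → All.all⁻ _ (All.tabulate λ Y∈ → ¬T⇒T-not (indexed X∈ Y∈)))
  where
  indexed : ∀ {X Y} → X ∈ members vs S → Y ∈ members vs S → ¬ T (adjJ X Y)
  indexed X∈ Y∈ with ∈-members⁻ vs S X∈ | ∈-members⁻ vs S Y∈
  ... | _ , Si , refl | _ , Sj , refl = nonadjacent Si Sj

invariant-stable⇒avoids : {e f : Fin n} → e ≢ f → (vs : List (Subset n)) (S : Subset (length vs)) →
                          T (stable vs S) → T (invariant e f vs S) →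
                          ∀ {X} → X ∈ members vs S → ¬ T (lookup X e xor lookup X f)
invariant-stable⇒avoids {e = e} {f} e≢f vs S st inv {X} X∈ X∈H
  with find (any⁻ _ _ (All.lookup (All.all⁺ _ _ (proj₁ (Equivalence.to T-∧ inv))) X∈))
... | Y , Y∈ , Y≡πX = stable⁻ vs S st X∈ Y∈ (subst (T ∘ adjJ X) (sym (toWitness Y≡πX)) (act-adjJ e≢f X X∈H))

module _ {P : Pred (Fin n) ℓ} (P? : Decidable P) where

  select : Fin n → Fin n
  select d with any? P?
  ... | yes (x , _) = x
  ... | no _        = d

  select-satisfies-or-default : ∀ d → P (select d) ⊎ select d ≡ d
  select-satisfies-or-default d with any? P?
  ... | yes (_ , px) = inj₁ px
  ... | no _         = inj₂ refl

  select-satisfies : ∀ d {x} → P x → P (select d)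
  select-satisfies d {x} px with any? P?
  ... | yes (_ , py) = py
  ... | no ¬∃P       = contradiction (x , px) ¬∃P

  select-preserves : (Q : Fin n → Set) → (∀ {x} → P x → Q x) → ∀ {d} → Q d → Q (select d)
  select-preserves Q P⇒Q {d} Qd with select-satisfies-or-default d
  ... | inj₁ p  = P⇒Q p
  ... | inj₂ eq = subst Q (sym eq) Qd

  select≡⇔ : (∀ {x y} → P x → P y → x ≡ y) → ∀ {d b} → b ≢ d → P b ⇔ select d ≡ b
  select≡⇔ unique {d} {b} b≢d = mk⇔ (λ pb → unique (select-satisfies d pb) pb) from
    where
    from : select d ≡ b → P b
    from eq with select-satisfies-or-default d
    ... | inj₁ p    = subst P eq p
    ... | inj₂ eq′  = contradiction (trans (sym eq) eq′) b≢d

exchangePairs : Subset n → List (Fin n × Fin n)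
exchangePairs s = cartesianProduct (elements s) (elements (∁ s))

∈-exchangePairs : ∀ {s : Subset n} {a b} → lookup s a ≡ true → lookup s b ≡ false → (a , b) ∈ exchangePairs s
∈-exchangePairs {s = s} {b = b} sa sb =
  ∈-cartesianProductWith⁺ _,_ (∈-elements s sa) (∈-elements (∁ s) (trans (lookup-map b not s) (cong not sb)))

length-exchangePairs : (s : Subset n) → length (exchangePairs s) ≡ ∣ s ∣ * (n ∸ ∣ s ∣)
length-exchangePairs s = trans (length-cartesianProductWith _,_ (elements s) (elements (∁ s)))
  (cong₂ _*_ (length-elements s) (trans (length-elements (∁ s)) (∣∁p∣≡n∸∣p∣ s)))

codes : List (Subset n) → List (List (Fin n × Fin n))
codes []       = [ [] ]
codes (s ∷ Ls) = cartesianProductWith _∷_ (exchangePairs s) (codes Ls)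

length-codes : ∀ {r} (Ls : List (Subset n)) → All (λ s → ∣ s ∣ ≡ r) Ls →
               length (codes Ls) ≡ (r * (n ∸ r)) ^ length Ls
length-codes []       []          = refl
length-codes (s ∷ Ls) (refl ∷ rs) = trans (length-cartesianProductWith _∷_ (exchangePairs s) (codes Ls))
  (cong₂ _*_ (length-exchangePairs s) (length-codes Ls rs))

∈-codes : (g : Subset n → Fin n × Fin n) (Ls : List (Subset n)) →
          (∀ {s} → s ∈ Ls → g s ∈ exchangePairs s) → map g Ls ∈ codes Ls
∈-codes g []       _    = here refl
∈-codes g (s ∷ Ls) g∈ = ∈-cartesianProductWith⁺ _∷_ (g∈ (here refl)) (∈-codes g Ls (g∈ ∘ there))

module JohnsonCount (n r : ℕ) (e f : Fin n) (e≢f : e ≢ f) where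

  Vs : List (Subset n)
  Vs = JohnsonVertices n r

  N : ℕ
  N = length Vs

  vertex : Fin N → Subset n
  vertex = List.lookup Vs

  Hs : List (Subset n)
  Hs = HVertices n r e f

  inH : Subset n → Bool
  inH X = lookup X e xor lookup X f

  Vs-unique : Unique Vs
  Vs-unique = Unique.filter⁺ _ (allSubsets-unique n)

  Hs-unique : Unique Hs
  Hs-unique = Unique.filter⁺ _ Vs-unique

  ∈Vs⇒∣∣≡r : ∀ {X} → X ∈ Vs → ∣ X ∣ ≡ r
  ∈Vs⇒∣∣≡r = ≡ᵇ⇒≡ _ r ∘ ∈-filterᵇ⇒T (λ X → ∣ X ∣ ≡ᵇ r) (allSubsets n)

  ∈Hs⇒∈Vs×inH : ∀ {X} → X ∈ Hs → X ∈ Vs × T (inH X)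
  ∈Hs⇒∈Vs×inH = ∈-filter⁻ (T? ∘ inH)

  position : Fin (length Hs) → Fin N
  position i = Any.index (proj₁ (∈Hs⇒∈Vs×inH (∈-lookup i)))

  vertex-position : ∀ i → vertex (position i) ≡ List.lookup Hs i
  vertex-position i = sym (lookup-index (proj₁ (∈Hs⇒∈Vs×inH (∈-lookup i))))

  pin pout : Subset n → Fin n
  pin  s = if lookup s e then e else f
  pout s = if lookup s e then f else e

  pin∈ : ∀ s → T (inH s) → lookup s (pin s) ≡ true
  pin∈ s s∈H with lookup s e in se
  ... | true  = se
  ... | false = Equivalence.to T-≡ s∈H

  pout∉ : ∀ s → T (inH s) → lookup s (pout s) ≡ false
  pout∉ s s∈H with lookup s e in se
  ... | true  = Equivalence.to T-not-≡ s∈H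
  ... | false = se

  pin-pout-agree : ∀ s Y → ¬ T (inH Y) → lookup Y (pin s) ≡ lookup Y (pout s)
  pin-pout-agree s Y Y∉H with lookup s e
  ... | true  = ¬T-xor⇒≡ Y∉H
  ... | false = sym (¬T-xor⇒≡ Y∉H)

  witnessIn : {C : Pred (Fin n) ℓ} → Decidable C → (Fin n → Subset n) → Subset N → Fin n → Fin n
  witnessIn C? φ I = select (λ x → C? x ×-dec (φ x ∈ˢ? members Vs I))

  lookup⇔witnessIn≡ : {C : Pred (Fin n) ℓ} (C? : Decidable C) (φ : Fin n → Subset n) →
                      (∀ {x y} → C x → C y → x ≢ y → T (adjJ (φ x) (φ y))) →
                      ∀ {I} → T (stable Vs I) → ∀ {v b d} → C b → b ≢ d → vertex v ≡ φ b →
                      lookup I v ≡ true ⇔ witnessIn C? φ I d ≡ b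
  lookup⇔witnessIn≡ {C = C} C? φ spread {I} I-stable {v} {b} Cb b≢d v≡φb = select≡⇔ _ unique b≢d ⇔-∘ mk⇔
    (λ Iv → Cb , subst (_∈ members Vs I) v≡φb (∈-members⁺ Vs I Iv))
    (λ (_ , φb∈) → Equivalence.to (lookup∈members⇔ Vs-unique I v) (subst (_∈ members Vs I) (sym v≡φb) φb∈))
    where
    unique : ∀ {x y} → C x × φ x ∈ members Vs I → C y × φ y ∈ members Vs I → x ≡ y
    unique {x} {y} (Cx , φx∈) (Cy , φy∈) with x ≟ y
    ... | yes x≡y = x≡y
    ... | no x≢y  = contradiction (spread Cx Cy x≢y) (stable⁻ Vs I I-stable φx∈ φy∈)

  added removed : Subset n → Subset N → Fin n
  added   s I = witnessIn (λ b → lookup s b Bool.≟ false) (replace s (pin s)) I (pout s)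
  removed s I = witnessIn (λ a → lookup s a Bool.≟ true) (λ a → replace s a (pout s)) I (pin s)

  code : List (Subset n) → Subset N → List (Fin n × Fin n)
  code Ls I = map (λ s → removed s I , added s I) Ls

  code∈exchangePairs : ∀ {s} → T (inH s) → ∀ I → (removed s I , added s I) ∈ exchangePairs s
  code∈exchangePairs {s} s∈H I = ∈-exchangePairs {s = s}
    (select-preserves _ (λ a → lookup s a ≡ true) proj₁ (pin∈ s s∈H))
    (select-preserves _ (λ b → lookup s b ≡ false) proj₁ (pout∉ s s∈H))

  same-code⇒same-on-neighbour : ∀ {s I₁ I₂ v} → T (inH s) → ∣ s ∣ ≡ r →
                                T (stable Vs I₁) → T (stable Vs I₂) →
                                (removed s I₁ , added s I₁) ≡ (removed s I₂ , added s I₂) →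
                                ¬ T (inH (vertex v)) → T (adjJ s (vertex v)) → lookup I₁ v ≡ lookup I₂ v
  same-code⇒same-on-neighbour {s} {I₁} {I₂} {v} s∈H ∣s∣≡r st₁ st₂ same v∉H s~v
    with neighbour-shapes {s = s} {Y = vertex v} (pin∈ s s∈H) (pout∉ s s∈H)
           (trans ∣s∣≡r (sym (∈Vs⇒∣∣≡r (∈-lookup v)))) s~v (pin-pout-agree s (vertex v) v∉H)
  ... | inj₁ (b , sb , b≢q , v≡) = ≡-from-⇔≡ (added-spec st₁) (added-spec st₂) (cong proj₂ same)
    where
    added-spec : ∀ {I} → T (stable Vs I) → lookup I v ≡ true ⇔ added s I ≡ b
    added-spec st = lookup⇔witnessIn≡ (λ b → lookup s b Bool.≟ false) (replace s (pin s))
                      (replace-new-adjJ s (pin∈ s s∈H)) st sb b≢q v≡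
  ... | inj₂ (a , sa , a≢p , v≡) = ≡-from-⇔≡ (removed-spec st₁) (removed-spec st₂) (cong proj₁ same)
    where
    removed-spec : ∀ {I} → T (stable Vs I) → lookup I v ≡ true ⇔ removed s I ≡ a
    removed-spec st = lookup⇔witnessIn≡ (λ a → lookup s a Bool.≟ true) (λ a → replace s a (pout s))
                        (λ sa′ sb′ → replace-old-adjJ s sa′ sb′ (pout∉ s s∈H)) st sa a≢p v≡

  AvoidsH : Subset N → Set
  AvoidsH I = ∀ v → T (inH (vertex v)) → lookup I v ≡ false

  hPart : Subset N → Subset N
  hPart J = tabulate λ v → lookup J v ∧ inH (vertex v)

  mask : List (Subset n) → Subset N
  mask Ls = tabulate λ v → does (vertex v ∈ˢ? Ls)

  graft : List (Subset n) → Subset N → Subset N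
  graft Ls I = tabulate λ v → (lookup I v ∧ not (any (adjJ (vertex v)) Ls)) ∨ does (vertex v ∈ˢ? Ls)

  module Graft (Ls : List (Subset n)) (Ls-stable : ∀ {X Y} → X ∈ Ls → Y ∈ Ls → ¬ T (adjJ X Y))
               (Ls⊆Hs : Ls ⊆ Hs) where

    Ls⊆H : ∀ {X} → X ∈ Ls → T (inH X)
    Ls⊆H = proj₂ ∘ ∈Hs⇒∈Vs×inH ∘ Ls⊆Hs

    lookup-graft : ∀ I v → lookup (graft Ls I) v ≡
                           (lookup I v ∧ not (any (adjJ (vertex v)) Ls)) ∨ does (vertex v ∈ˢ? Ls)
    lookup-graft I = lookup∘tabulate _

    GraftCase : Subset N → Fin N → Set
    GraftCase I v = (lookup I v ≡ true × ∀ {Y} → Y ∈ Ls → ¬ T (adjJ (vertex v) Y)) ⊎ vertex v ∈ Ls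

    graft-cases : ∀ I v → lookup (graft Ls I) v ≡ true → GraftCase I v
    graft-cases I v gv rewrite lookup-graft I v
      with lookup I v | any (adjJ (vertex v)) Ls in v~Ls | vertex v ∈ˢ? Ls
    ... | _     | _     | yes v∈ = inj₂ v∈
    ... | true  | false | no _   = inj₁ (refl , λ Y∈ v~Y → ≡false⇒¬T v~Ls (any⁺ _ (Any.map (λ { refl → v~Y }) Y∈)))
    ... | true  | true  | no _   with () ← gv
    ... | false | _     | no _   with () ← gv

    graft-stable : ∀ I → T (stable Vs I) → T (stable Vs (graft Ls I))
    graft-stable I I-stable = stable⁺ Vs (graft Ls I) λ {v} {w} gv gw →
      nonadjacent (graft-cases I v gv) (graft-cases I w gw)
      where
      nonadjacent : ∀ {v w} → GraftCase I v → GraftCase I w → ¬ T (adjJ (vertex v) (vertex w))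
      nonadjacent (inj₁ (Iv , _))    (inj₁ (Iw , _))    =
        stable⁻ Vs I I-stable (∈-members⁺ Vs I Iv) (∈-members⁺ Vs I Iw)
      nonadjacent (inj₁ (_ , v≁Ls))  (inj₂ w∈)          = v≁Ls w∈
      nonadjacent {v} {w} (inj₂ v∈)  (inj₁ (_ , w≁Ls))  = w≁Ls v∈ ∘ subst T (adjJ-sym (vertex v) (vertex w))
      nonadjacent (inj₂ v∈)          (inj₂ w∈)          = Ls-stable v∈ w∈

    graft-hPart : ∀ I → AvoidsH I → hPart (graft Ls I) ≡ mask Ls
    graft-hPart I I-avoids = tabulate-cong pointwise
      where
      pointwise : ∀ v → lookup (graft Ls I) v ∧ inH (vertex v) ≡ does (vertex v ∈ˢ? Ls)
      pointwise v rewrite lookup-graft I v with vertex v ∈ˢ? Ls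
      ... | yes v∈ = trans (cong (_∧ inH (vertex v)) (∨-zeroʳ _)) (Equivalence.to T-≡ (Ls⊆H v∈))
      ... | no _   with lookup I v in Iv | inH (vertex v) in v∈H
      ...   | false | _     = refl
      ...   | true  | false = ∧-zeroʳ _
      ...   | true  | true  = contradiction (trans (sym Iv) (I-avoids v (Equivalence.from T-≡ v∈H))) λ ()

    graft-outside : ∀ I {v} → any (adjJ (vertex v)) Ls ≡ false → vertex v ∉ Ls →
                    lookup (graft Ls I) v ≡ lookup I v
    graft-outside I {v} v≁Ls v∉Ls rewrite lookup-graft I v | v≁Ls | dec-false (vertex v ∈ˢ? Ls) v∉Ls =
      trans (∨-identityʳ _) (∧-identityʳ _)

    graft-code-injective : ∀ {I₁ I₂} → T (stable Vs I₁) → AvoidsH I₁ → T (stable Vs I₂) → AvoidsH I₂ →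
                           graft Ls I₁ ≡ graft Ls I₂ → code Ls I₁ ≡ code Ls I₂ → I₁ ≡ I₂
    graft-code-injective {I₁} {I₂} st₁ av₁ st₂ av₂ same-graft same-code = lookup-extensionality I₁ I₂ agree
      where
      agree : ∀ v → lookup I₁ v ≡ lookup I₂ v
      agree v with inH (vertex v) in v∈H
      ... | true  = trans (av₁ v (Equivalence.from T-≡ v∈H)) (sym (av₂ v (Equivalence.from T-≡ v∈H)))
      ... | false with any (adjJ (vertex v)) Ls in v~Ls
      ...   | false = trans (sym (graft-outside I₁ v~Ls v∉Ls))
                            (trans (cong (λ J → lookup J v) same-graft) (graft-outside I₂ v~Ls v∉Ls))
        where
        v∉Ls : vertex v ∉ Ls
        v∉Ls v∈ = ≡false⇒¬T v∈H (Ls⊆H v∈)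
      ...   | true with find (any⁻ _ Ls (Equivalence.from T-≡ v~Ls))
      ...     | s , s∈ , v~s = same-code⇒same-on-neighbour {s} {I₁} {I₂}
                  (Ls⊆H s∈) (∈Vs⇒∣∣≡r (proj₁ (∈Hs⇒∈Vs×inH (Ls⊆Hs s∈)))) st₁ st₂
                  (map-≡⇒≡-on _ _ same-code s∈) (≡false⇒¬T v∈H) (subst T (adjJ-sym (vertex v) s) v~s)

  invariantStable : List (Subset N)
  invariantStable = filterᵇ (λ I → stable Vs I ∧ invariant e f Vs I) (allSubsets N)

  stableSets : List (Subset N)
  stableSets = filterᵇ (stable Vs) (allSubsets N)

  stableOfSizeInH : ℕ → List (Subset (length Hs))
  stableOfSizeInH k = filterᵇ (λ S → stable Hs S ∧ (∣ S ∣ ≡ᵇ k)) (allSubsets (length Hs))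

  hasHPart : List (Subset n) → Subset N → Bool
  hasHPart Ls J = stable Vs J ∧ (hPart J ==ˢ mask Ls)

  fibre : Subset (length Hs) → List (Subset N)
  fibre S = filterᵇ (hasHPart (members Hs S)) (allSubsets N)

  ∈invariantStable⇒ : ∀ {I} → I ∈ invariantStable → T (stable Vs I) × AvoidsH I
  ∈invariantStable⇒ {I} I∈ = I-stable , I-avoids
    where
    I-stable,invariant =
      Equivalence.to T-∧ (∈-filterᵇ⇒T (λ I → stable Vs I ∧ invariant e f Vs I) (allSubsets N) I∈)
    I-stable = proj₁ I-stable,invariant
    I-avoids : AvoidsH I
    I-avoids v v∈H with lookup I v in Iv
    ... | false = refl
    ... | true  = contradiction v∈H
                    (invariant-stable⇒avoids e≢f Vs I I-stable (proj₂ I-stable,invariant) (∈-members⁺ Vs I Iv))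

  invariantStable≤fibre×codes : ∀ S → T (stable Hs S) →
                                length invariantStable ≤ length (fibre S) * length (codes (members Hs S))
  invariantStable≤fibre×codes S S-stable =
    subst (length invariantStable ≤_) (length-cartesianProductWith _,_ (fibre S) (codes Ls))
      (injection⇒length≤ (cartesianProduct (fibre S) (codes Ls)) (λ I → graft Ls I , code Ls I)
        (Unique.filter⁺ _ (allSubsets-unique N)) injective into)
    where
    Ls = members Hs S
    open Graft Ls (stable⁻ Hs S S-stable) (members-⊆ Hs S)
    injective : ∀ {I J} → I ∈ invariantStable → J ∈ invariantStable →
                (graft Ls I , code Ls I) ≡ (graft Ls J , code Ls J) → I ≡ J
    injective I∈ J∈ eq with ∈invariantStable⇒ I∈ | ∈invariantStable⇒ J∈
    ... | st₁ , av₁ | st₂ , av₂ = graft-code-injective st₁ av₁ st₂ av₂ (cong proj₁ eq) (cong proj₂ eq)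
    into : ∀ {I} → I ∈ invariantStable → (graft Ls I , code Ls I) ∈ cartesianProduct (fibre S) (codes Ls)
    into {I} I∈ with ∈invariantStable⇒ I∈
    ... | st , av = ∈-cartesianProductWith⁺ _,_
          (∈-filter⁺ (T? ∘ hasHPart Ls) (∈-allSubsets (graft Ls I))
            (Equivalence.from T-∧ (graft-stable I st , fromWitness (graft-hPart I av))))
          (∈-codes _ Ls λ {s} s∈ → code∈exchangePairs {s} (Ls⊆H s∈) I)

  invariantStable≤fibre : ∀ {k S} → S ∈ stableOfSizeInH k →
                          length invariantStable ≤ (r * (n ∸ r)) ^ k * length (fibre S)
  invariantStable≤fibre {k} {S} S∈ = begin
    length invariantStable                              ≤⟨ invariantStable≤fibre×codes S S-stable ⟩
    length (fibre S) * length (codes (members Hs S))    ≡⟨ cong (length (fibre S) *_)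
                                                                (length-codes _ (All.tabulate size)) ⟩
    length (fibre S) * (r * (n ∸ r)) ^ length (members Hs S)
                                                        ≡⟨ cong (λ m → length (fibre S) * (r * (n ∸ r)) ^ m)
                                                                (trans (length-members Hs S) ∣S∣≡k) ⟩
    length (fibre S) * (r * (n ∸ r)) ^ k                ≡⟨ *-comm (length (fibre S)) _ ⟩
    (r * (n ∸ r)) ^ k * length (fibre S)                ∎
    where
    open ≤-Reasoning
    S-stable,size =
      Equivalence.to T-∧ (∈-filterᵇ⇒T (λ S → stable Hs S ∧ (∣ S ∣ ≡ᵇ k)) (allSubsets (length Hs)) S∈)
    S-stable = proj₁ S-stable,size
    ∣S∣≡k = ≡ᵇ⇒≡ _ k (proj₂ S-stable,size)
    size : ∀ {X} → X ∈ members Hs S → ∣ X ∣ ≡ r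
    size = ∈Vs⇒∣∣≡r ∘ proj₁ ∘ ∈Hs⇒∈Vs×inH ∘ members-⊆ Hs S

  lookup-mask-members : ∀ S i → lookup (mask (members Hs S)) (position i) ≡ lookup S i
  lookup-mask-members S i = begin
    lookup (mask (members Hs S)) (position i)     ≡⟨ lookup∘tabulate _ (position i) ⟩
    does (vertex (position i) ∈ˢ? members Hs S)   ≡⟨ cong (λ X → does (X ∈ˢ? members Hs S)) (vertex-position i) ⟩
    does (List.lookup Hs i ∈ˢ? members Hs S)      ≡⟨ ≡-from-⇔ (lookup∈members⇔ Hs-unique S i ⇔-∘ does⇔ _∈?_) ⟩
    lookup S i                                    ∎
    where
    open ≡-Reasoning
    _∈?_ = List.lookup Hs i ∈ˢ? members Hs S

  mask-members-injective : ∀ {S₁ S₂} → mask (members Hs S₁) ≡ mask (members Hs S₂) → S₁ ≡ S₂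
  mask-members-injective {S₁} {S₂} eq = lookup-extensionality S₁ S₂ λ i →
    trans (sym (lookup-mask-members S₁ i)) (trans (cong (λ M → lookup M (position i)) eq) (lookup-mask-members S₂ i))

  fibres-disjoint : ∀ {S₁ S₂} → S₁ ≢ S₂ → Disjoint (fibre S₁) (fibre S₂)
  fibres-disjoint S₁≢S₂ (J∈₁ , J∈₂) = S₁≢S₂ (mask-members-injective (trans (sym (hPart≡ J∈₁)) (hPart≡ J∈₂)))
    where
    hPart≡ : ∀ {S J} → J ∈ fibre S → hPart J ≡ mask (members Hs S)
    hPart≡ {S} {J} J∈ = toWitness {a? = ≡-dec Bool._≟_ (hPart J) (mask (members Hs S))}
      (proj₂ (Equivalence.to T-∧ (∈-filterᵇ⇒T (hasHPart (members Hs S)) (allSubsets N) J∈)))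

  Σfibres≤stableSets : ∀ k → length (concatMap fibre (stableOfSizeInH k)) ≤ length stableSets
  Σfibres≤stableSets k = unique-⊆⇒length≤
    (Unique.concat⁺ (All.map⁺ (All.universal (λ _ → Unique.filter⁺ _ (allSubsets-unique N)) (stableOfSizeInH k)))
                    (AllPairs.map⁺ (AllPairs.map fibres-disjoint (Unique.filter⁺ _ (allSubsets-unique (length Hs))))))
    fibre⊆stableSets
    where
    fibre⊆stableSets : concatMap fibre (stableOfSizeInH k) ⊆ stableSets
    fibre⊆stableSets J∈ with Any.satisfied (∈-concatMap⁻ fibre {xs = stableOfSizeInH k} J∈)
    ... | S , J∈S = ∈-filter⁺ (T? ∘ stable Vs) (∈-allSubsets _)
                      (proj₁ (Equivalence.to T-∧ (∈-filterᵇ⇒T (hasHPart (members Hs S)) (allSubsets N) J∈S)))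

lemma3p6 : (n r : ℕ) → 2 ≤ n → r ≤ n → (e f : Fin n) → e ≢ f →
           (k : ℕ) → 0 < ikH n r e f k →
           iπJ n r e f * ikH n r e f k ≤ (r * (n ∸ r)) ^ k * iJ n r
lemma3p6 n r _ _ e f e≢f k _ = begin
  length invariantStable * length Q            ≡⟨ *-comm (length invariantStable) (length Q) ⟩
  length Q * length invariantStable            ≤⟨ length*≤*sum {d = m ^ k} (length ∘ fibre) Q invariantStable≤fibre ⟩
  m ^ k * sum (map (length ∘ fibre) Q)         ≡⟨ cong (m ^ k *_) (length-concatMap fibre Q) ⟨
  m ^ k * length (concatMap fibre Q)           ≤⟨ *-monoʳ-≤ (m ^ k) (Σfibres≤stableSets k) ⟩
  m ^ k * length stableSets                    ∎
  where
  open JohnsonCount n r e f e≢f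
  open ≤-Reasoning
  m = r * (n ∸ r)
  Q = stableOfSizeInH k
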